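{- For every $a\in\mathcal{A}^+$ there exists $n_a\in\mathbb{N}$ such that $P(a)=0$ for every $P\in\mathcal{P}(n_a)$; that is, the dendriform coalgebra $(\mathcal{A},\Delta_\leftarrow,\Delta_\rightarrow)$ is connected.
   Context: A reduced tree is a planar rooted tree (root edge below the root, leaves as top edges) whose internal vertices have at least two children; $|$ is the one-leaf tree; $T_n$ = reduced trees with $n+1$ leaves; $\mathcal{A}_n=\mathbb{K}T_n$, $\mathcal{A}=\bigoplus_{n\ge0}\mathcal{A}_n$, $\mathcal{A}^+=\bigoplus_{n\ge1}\mathcal{A}_n$. Product $*$ on $\mathcal{A}$: with $x^{(0)}\vee\cdots\vee x^{(k)}$ the grafting of trees left to right on a new root, recursively $x\prec y=x^{(0)}\vee\cdots\vee x^{(k-1)}\vee(x^{(k)}*y)$, $x\cdot y=x^{(0)}\vee\cdots\vee x^{(k-1)}\vee(x^{(k)}*y^{(0)})\vee y^{(1)}\vee\cdots\vee y^{(l)}$, $x\succ y=(x*y^{(0)})\vee y^{(1)}\vee\cdots\vee y^{(l)}$, $*=\prec+\cdot+\succ$, $|$ the unit. Admissible cuts: an internal edge joins two internal vertices; an admissible cut is a nonempty set $c$ of internal edges with at most one on each root-to-leaf path, or the empty cut, or the total cut; removing the edges of a nonempty non-total $c$ gives subtrees $G^c_1(t),\dots,G^c_m(t)$ (left to right; cut edges become root edges) and the root component $P^c(t)$ (cut edges become leaves), $G^c(t)=G^c_1(t)*\cdots*G^c_m(t)$; empty cut: $P^c=t,G^c=|$; total cut: $P^c=|,G^c=t$.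 For trees $t\neq|$: $\tilde\Delta_\leftarrow(t)$ is the sum of $G^c(t)\otimes P^c(t)$ over admissible cuts such that the right-most leaf of $t$ lies in some $G^c_i(t)$ (including the total cut), minus $t\otimes|$; $\tilde\Delta_\rightarrow(t)$ is the sum over admissible cuts such that the right-most leaf lies in $P^c(t)$ (including the empty cut), minus $|\otimes t$. Extend linearly to $\mathcal{A}^+$. $\mathcal{P}(0)=\{Id\}$, $\mathcal{P}(1)=\{\tilde\Delta_\leftarrow,\tilde\Delta_\rightarrow\}$, and $\mathcal{P}(n)$ is the set of maps $(Id^{\otimes(i-1)}\otimes\tilde\Delta_\triangleright\otimes Id^{\otimes(n-i)})\circ P$ with $P\in\mathcal{P}(n-1)$, $i\in\{1,\dots,n\}$, $\triangleright\in\{\leftarrow,\rightarrow\}$. -}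

module Defs where

open import Level using (Level; _⊔_)
open import Data.Bool using (Bool; true; false)
import Data.Bool
import Data.Nat
import Data.List.Relation.Unary.All
import Data.Product
open import Data.Nat using (ℕ; zero; suc)
open import Data.Fin using (Fin; zero; suc)
open import Data.List using (List; []; _∷_; _++_; map; concatMap; foldr; filter)
open import Data.Vec using (Vec; []; _∷_)
import Data.Vec.Properties as VecP
open import Data.Product using (_×_; _,_; Σ; ∃)
open import Relation.Nullary using (¬_; Dec; yes; no)
open import Relation.Binary.PropositionalEquality using (_≡_; refl; cong)
open import Relation.Binary.Definitions using (DecidableEquality)
open import Algebra.Bundles using (CommutativeRing)

record Field (c ℓ : Level) : Set (Level.suc (c ⊔ ℓ)) where
  field
    commutativeRing : CommutativeRing c ℓ
  open CommutativeRing commutativeRing public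
  field
    1≉0     : ¬ (1# ≈ 0#)
    inverse : ∀ x → ¬ (x ≈ 0#) → Σ Carrier λ y → x * y ≈ 1#

-- Reduced planar rooted trees.  'leaf' is the one-leaf tree |.
-- 'node t₀ t₁ ts' is the grafting t₀ ∨ t₁ ∨ ts on a new root, so every
-- internal vertex has at least two children (listed left to right).

data Tree : Set where
  leaf : Tree
  node : Tree → Tree → List Tree → Tree

-- grafting x⁽⁰⁾ ∨ ⋯ ∨ x⁽ᵏ⁾ of a list of trees of length ≥ 2
-- (only ever applied to lists of length ≥ 2 below; [] and [t] are
-- sent to | resp. t, a harmless convention never used)
graft : List Tree → Tree
graft []             = leaf
graft (t ∷ [])       = t
graft (t₀ ∷ t₁ ∷ ts) = node t₀ t₁ ts

-- number of leaves (T_n = trees with n+1 leaves)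
mutual
  leaves : Tree → ℕ
  leaves leaf          = 1
  leaves (node a b ts) = leaves a Data.Nat.+ (leaves b Data.Nat.+ leavesL ts)

  leavesL : List Tree → ℕ
  leavesL []       = 0
  leavesL (t ∷ ts) = leaves t Data.Nat.+ leavesL ts

mutual
  _≟T_ : DecidableEquality Tree
  leaf ≟T leaf = yes refl
  leaf ≟T node _ _ _ = no λ ()
  node _ _ _ ≟T leaf = no λ ()
  node a b ts ≟T node a' b' ts' with a ≟T a' | b ≟T b' | ts ≟L ts'
  ... | yes refl | yes refl | yes refl = yes refl
  ... | no ne | _ | _ = no λ { refl → ne refl }
  ... | yes _ | no ne | _ = no λ { refl → ne refl }
  ... | yes _ | yes _ | no ne = no λ { refl → ne refl }

  _≟L_ : DecidableEquality (List Tree)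
  [] ≟L [] = yes refl
  [] ≟L (_ ∷ _) = no λ ()
  (_ ∷ _) ≟L [] = no λ ()
  (t ∷ ts) ≟L (t' ∷ ts') with t ≟T t' | ts ≟L ts'
  ... | yes refl | yes refl = yes refl
  ... | no ne | _ = no λ { refl → ne refl }
  ... | yes _ | no ne = no λ { refl → ne refl }

-- The product * on basis trees.  Its structure constants are all 1, so
-- x * y is returned as the list of trees (with multiplicity) whose sum
-- it is.

mutual
  _⊛_ : Tree → Tree → List Tree
  leaf ⊛ y = y ∷ []
  node a b as ⊛ leaf = node a b as ∷ []
  node a b as ⊛ node c d cs =
       prec a b as (node c d cs)
    ++ dot a b as c d cs
    ++ succ (node a b as) c d cs

  lastMul : Tree → List Tree → Tree → List (List Tree)
  lastMul h []         y = map (λ t → t ∷ []) (h ⊛ y)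
  lastMul h (h' ∷ hs) y = map (h ∷_) (lastMul h' hs y)

  -- x ≺ y = x⁽⁰⁾ ∨ ⋯ ∨ x⁽ᵏ⁻¹⁾ ∨ (x⁽ᵏ⁾ * y),   x = node a b as
  prec : Tree → Tree → List Tree → Tree → List Tree
  prec a b as y = map (λ l → graft (a ∷ l)) (lastMul b as y)

  -- x · y = x⁽⁰⁾ ∨ ⋯ ∨ x⁽ᵏ⁻¹⁾ ∨ (x⁽ᵏ⁾ * y⁽⁰⁾) ∨ y⁽¹⁾ ∨ ⋯ ∨ y⁽ˡ⁾,
  -- x = node a b as, y = node c d cs
  dot : Tree → Tree → List Tree → Tree → Tree → List Tree → List Tree
  dot a b as c d cs = map (λ l → graft (a ∷ (l ++ (d ∷ cs)))) (lastMul b as c)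

  -- x ≻ y = (x * y⁽⁰⁾) ∨ y⁽¹⁾ ∨ ⋯ ∨ y⁽ˡ⁾,  y = node c d cs
  succ : Tree → Tree → Tree → List Tree → List Tree
  succ x c d cs = map (λ t → node t d cs) (x ⊛ c)

prodList : List Tree → List Tree
prodList []       = leaf ∷ []
prodList (g ∷ gs) = concatMap (λ u → g ⊛ u) (prodList gs)

-- A (possibly empty) admissible cut c of t, i.e. a set of internal
-- edges with at most one on each root-to-leaf path, is recorded by the
-- data it determines:
--   pieces  = G^c₁(t), …, G^c_m(t)  (left to right),
--   root    = P^c(t),
--   rightP  = true iff the right-most leaf of t lies in P^c(t).

record CutData : Set where
  constructor cutData
  field
    pieces : List Tree
    root   : Tree
    rightP : Bool

mutual
  -- Choices inside a subtree s hanging from an internal vertex: the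
  -- edge above s is internal iff s is not a leaf; it may then be cut
  -- (s becomes a piece, the edge becomes a leaf of P), or not cut and
  -- we choose a cut inside s.
  below : Tree → List CutData
  below leaf = cutData [] leaf true ∷ []
  below (node a b as) =
    cutData (node a b as ∷ []) leaf false ∷ inside (node a b as)

  -- All admissible cuts of a tree t ≠ | using only edges strictly above
  -- its root vertex, including the empty one (one entry per cut).
  inside : Tree → List CutData
  inside leaf = []
  inside (node a b as) =
    concatMap (λ { (cutData g p _) →
       map (λ { (gs , ps , r) → cutData (g ++ gs) (graft (p ∷ ps)) r })
           (chain b as) })
      (below a)

  -- independent choices below each of the children s ∷ ss (left to
  -- right): (pieces, root components of the children, flag of the last
  -- child)
  chain : Tree → List Tree → List (List Tree × List Tree × Bool)
  chain s [] = map (λ { (cutData g p r) → (g , p ∷ [] , r) }) (below s)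
  chain s (s' ∷ ss) =
    concatMap (λ { (cutData g p _) →
       map (λ { (gs , ps , r) → (g ++ gs , p ∷ ps , r) }) (chain s' ss) })
      (below s)

module Lin {c ℓ : Level} (K : Field c ℓ) where
  open Field K using (Carrier; _≈_; _+_; _*_; -_; 0#; 1#)

  LC : Set → Set c
  LC B = List (Carrier × B)

  coeff : {B : Set} → DecidableEquality B → B → LC B → Carrier
  coeff _≟_ b [] = 0#
  coeff _≟_ b ((k , b') ∷ l) with b' ≟ b
  ... | yes _ = k + coeff _≟_ b l
  ... | no  _ = coeff _≟_ b l

  IsZero : {B : Set} → DecidableEquality B → LC B → Set ℓ
  IsZero {B} _≟_ l = ∀ (b : B) → coeff _≟_ b l ≈ 0#

  ones : {B : Set} → List B → LC B
  ones = map (λ b → (1# , b))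

  cutTerm : CutData → LC (Tree × Tree)
  cutTerm (cutData gs p _) = ones (map (λ g → (g , p)) (prodList gs))

  -- all admissible cuts of t ≠ |: the empty and nonempty non-total ones
  -- (inside t) together with the total cut (P = |, G = t, right-most leaf
  -- in G).
  allCuts : Tree → List CutData
  allCuts t = inside t ++ (cutData (t ∷ []) leaf false ∷ [])

  isLeft isRight : CutData → Bool
  isLeft  (cutData _ _ r) = Data.Bool.not r
  isRight (cutData _ _ r) = r

  -- Δ̃← and Δ̃→ on basis trees t ≠ |.  (They are only ever applied to
  -- elements of A⁺; on | we put 0 by convention, never used.)
  Δ← : Tree → LC (Tree × Tree)
  Δ← leaf = []
  Δ← t    = concatMap cutTerm (filter (λ cd → Data.Bool.T? (isLeft cd)) (allCuts t))
            ++ ((- 1# , (t , leaf)) ∷ [])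

  Δ→ : Tree → LC (Tree × Tree)
  Δ→ leaf = []
  Δ→ t    = concatMap cutTerm (filter (λ cd → Data.Bool.T? (isRight cd)) (allCuts t))
            ++ ((- 1# , (leaf , t)) ∷ [])

  data Dir : Set where
    left right : Dir

  Δ̃ : Dir → Tree → LC (Tree × Tree)
  Δ̃ left = Δ←
  Δ̃ right = Δ→

  applyAt : ∀ {n} → (Tree → LC (Tree × Tree)) → Fin (suc n) →
            Vec Tree (suc n) → LC (Vec Tree (suc (suc n)))
  applyAt f zero (t ∷ ts) = map (λ { (k , (g , p)) → (k , g ∷ p ∷ ts) }) (f t)
  applyAt {suc n} f (suc i) (t ∷ ts) = map (λ { (k , v) → (k , t ∷ v) }) (applyAt f i ts)

  extend : ∀ {B C : Set} → (B → LC C) → LC B → LC C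
  extend f = concatMap (λ { (k , b) → map (λ { (k' , c) → (k * k' , c) }) (f b) })

  -- Codes for the elements of 𝒫(n): P ∈ 𝒫(n-1), i ∈ {1..n}, ▷ ∈ {←,→}
  data Ops : ℕ → Set where
    idOp : Ops zero
    step : ∀ {n} → Ops n → Fin (suc n) → Dir → Ops (suc n)

  ⟦_⟧ : ∀ {n} → Ops n → LC Tree → LC (Vec Tree (suc n))
  ⟦ idOp ⟧       a = map (λ { (k , t) → (k , t ∷ []) }) a
  ⟦ step P i d ⟧ a = extend (applyAt (Δ̃ d) i) (⟦ P ⟧ a)

  _≟V_ : ∀ {n} → DecidableEquality (Vec Tree n)
  _≟V_ = VecP.≡-dec _≟T_

  InAPlus : LC Tree → Set c
  InAPlus a = Data.List.Relation.Unary.All.All (λ kt → ¬ (Data.Product.proj₂ kt ≡ leaf)) a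

-- Among the terms G ⊗ P of Δ̃(t), those coming from the empty and the total
-- cut contain | and cancel against the correction terms | ⊗ t and t ⊗ |. Every
-- other term has both factors in 𝒜⁺ and leaves G + leaves P = leaves t + 1,
-- because a product of trees with p and q leaves is a sum of trees with
-- p + q − 1 leaves. So, up to cancellation, P(a) for P ∈ 𝒫(n) is a sum of
-- tensors of n + 1 trees with at least two leaves each and at most L + n
-- leaves in total, L being the number of leaves in a; for n = L there is none.

module Submission where

open import Defs
open import Level using (Level)
open import Function using (_∘_)
open import Data.Bool using (Bool; true; false; not; T; T?)
open import Data.Empty using (⊥-elim)
open import Data.Nat as Nat using (ℕ; suc; _≤_; z≤n; s≤s)
import Data.Nat.Properties as ℕ
open import Data.Nat.ListAction using (sum)
open import Data.List using (List; []; _∷_; _++_; map; concatMap; length; null; filterᵇ)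
import Data.List.Properties as List
open import Data.List.Relation.Unary.All as All using (All; []; _∷_)
open import Data.List.Relation.Unary.All.Properties using (++⁺; map⁺; concat⁺; filter⁺; all-filter)
open import Data.Vec as Vec using (Vec; []; _∷_)
open import Data.Vec.Relation.Unary.All as AllV using ([]; _∷_)
open import Data.Fin using (Fin; zero; suc)
open import Data.Product using (Σ; _×_; _,_; proj₁; proj₂; map₂)
open import Data.Product.Properties using (≡-dec)
open import Relation.Nullary using (¬_; yes; no)
open import Relation.Binary.Bundles using (Setoid)
open import Relation.Binary.Definitions using (DecidableEquality)
open import Relation.Binary.PropositionalEquality
  using (_≡_; refl; sym; trans; cong; cong₂; subst; module ≡-Reasoning)
open import Algebra.Properties.CommutativeSemigroup ℕ.+-commutativeSemigroup using (interchange)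

module _ {A B : Set} where

  filterᵇ-map : ∀ (p : B → Bool) (f : A → B) xs → filterᵇ p (map f xs) ≡ map f (filterᵇ (p ∘ f) xs)
  filterᵇ-map p f []       = refl
  filterᵇ-map p f (x ∷ xs) with p (f x)
  ... | true  = cong (f x ∷_) (filterᵇ-map p f xs)
  ... | false = filterᵇ-map p f xs

  filterᵇ-concatMap : ∀ (p : B → Bool) (f : A → List B) xs →
    filterᵇ p (concatMap f xs) ≡ concatMap (filterᵇ p ∘ f) xs
  filterᵇ-concatMap p f []       = refl
  filterᵇ-concatMap p f (x ∷ xs) =
    trans (List.filter-++ (T? ∘ p) (f x) (concatMap f xs)) (cong (filterᵇ p (f x) ++_) (filterᵇ-concatMap p f xs))

  concatMap-filterᵇ : ∀ (p : A → Bool) (f : A → List B) → (∀ x → p x ≡ false → f x ≡ []) →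
    ∀ xs → concatMap f xs ≡ concatMap f (filterᵇ p xs)
  concatMap-filterᵇ p f f-vanishes []       = refl
  concatMap-filterᵇ p f f-vanishes (x ∷ xs) with p x in px
  ... | true  = cong (f x ++_) (concatMap-filterᵇ p f f-vanishes xs)
  ... | false = cong₂ _++_ (f-vanishes x px) (concatMap-filterᵇ p f f-vanishes xs)

filterᵇ-comm : ∀ {A : Set} (p q : A → Bool) xs → filterᵇ p (filterᵇ q xs) ≡ filterᵇ q (filterᵇ p xs)
filterᵇ-comm p q []       = refl
filterᵇ-comm p q (x ∷ xs) with p x in px | q x in qx
... | true  | true  rewrite px | qx = cong (x ∷_) (filterᵇ-comm p q xs)
... | true  | false rewrite qx      = filterᵇ-comm p q xs
... | false | true  rewrite px      = filterᵇ-comm p q xs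
... | false | false                 = filterᵇ-comm p q xs

null-++ : ∀ {A : Set} (xs ys : List A) → null xs ≡ false → null (xs ++ ys) ≡ false
null-++ (_ ∷ _) ys refl = refl

filterᵇ-false : ∀ {A : Set} (p : A → Bool) → (∀ x → p x ≡ false) → ∀ xs → filterᵇ p xs ≡ []
filterᵇ-false p p-false xs = List.filter-none (T? ∘ p) (All.universal (λ x px → subst T (p-false x) px) xs)

-- Linear combinations up to equality of coefficients

module LinearCombinations {c ℓ : Level} (K : Field c ℓ) where
  open Field K
    using (Carrier; _≈_; _+_; _*_; -_; 0#; 1#; setoid; +-cong; *-cong; +-assoc; +-comm;
           +-identityˡ; +-identityʳ; zeroˡ; zeroʳ; distribˡ; distribʳ; *-identityʳ; -‿inverseʳ)
    renaming (refl to ≈-refl; sym to ≈-sym; trans to ≈-trans)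
  open Lin K
  open import Relation.Binary.Reasoning.Setoid setoid

  module _ {B : Set} (_≟_ : DecidableEquality B) where

    infix 4 _≋_
    record _≋_ (l l' : LC B) : Set ℓ where
      constructor mk≋
      field coeff-≈ : ∀ b → coeff _≟_ b l ≈ coeff _≟_ b l'
    open _≋_ public

    ≋-setoid : Setoid c ℓ
    ≋-setoid = record
      { Carrier       = LC B
      ; _≈_           = _≋_
      ; isEquivalence = record
        { refl  = mk≋ λ _ → ≈-refl
        ; sym   = λ e → mk≋ λ b → ≈-sym (coeff-≈ e b)
        ; trans = λ e e' → mk≋ λ b → ≈-trans (coeff-≈ e b) (coeff-≈ e' b)
        }
      }

    open Setoid ≋-setoid public using ()
      renaming (refl to ≋-refl; sym to ≋-sym; trans to ≋-trans; reflexive to ≋-reflexive)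

    coeff-++ : ∀ b l l' → coeff _≟_ b (l ++ l') ≈ coeff _≟_ b l + coeff _≟_ b l'
    coeff-++ b []             l' = ≈-sym (+-identityˡ _)
    coeff-++ b ((k , b') ∷ l) l' with b' ≟ b
    ... | yes _ = ≈-trans (+-cong ≈-refl (coeff-++ b l l')) (≈-sym (+-assoc _ _ _))
    ... | no  _ = coeff-++ b l l'

    ++-cong : ∀ {l₁ l₁' l₂ l₂'} → l₁ ≋ l₁' → l₂ ≋ l₂' → l₁ ++ l₂ ≋ l₁' ++ l₂'
    ++-cong {l₁} {l₁'} {l₂} {l₂'} e e' = mk≋ λ b → begin
      coeff _≟_ b (l₁ ++ l₂)                ≈⟨ coeff-++ b l₁ l₂ ⟩
      coeff _≟_ b l₁ + coeff _≟_ b l₂       ≈⟨ +-cong (coeff-≈ e b) (coeff-≈ e' b) ⟩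
      coeff _≟_ b l₁' + coeff _≟_ b l₂'     ≈⟨ coeff-++ b l₁' l₂' ⟨
      coeff _≟_ b (l₁' ++ l₂')              ∎

    ++-comm : ∀ l l' → l ++ l' ≋ l' ++ l
    ++-comm l l' = mk≋ λ b → begin
      coeff _≟_ b (l ++ l')                 ≈⟨ coeff-++ b l l' ⟩
      coeff _≟_ b l + coeff _≟_ b l'        ≈⟨ +-comm _ _ ⟩
      coeff _≟_ b l' + coeff _≟_ b l        ≈⟨ coeff-++ b l' l ⟨
      coeff _≟_ b (l' ++ l)                 ∎

    coeff-here : ∀ {b b'} k l → b' ≡ b → coeff _≟_ b ((k , b') ∷ l) ≈ k + coeff _≟_ b l
    coeff-here {b} {b'} k l b'≡b with b' ≟ b
    ... | yes _    = ≈-refl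
    ... | no b'≢b  = ⊥-elim (b'≢b b'≡b)

    coeff-there : ∀ {b b'} k l → ¬ b' ≡ b → coeff _≟_ b ((k , b') ∷ l) ≈ coeff _≟_ b l
    coeff-there {b} {b'} k l b'≢b with b' ≟ b
    ... | yes b'≡b = ⊥-elim (b'≢b b'≡b)
    ... | no _     = ≈-refl

    cancel : ∀ x → (1# , x) ∷ (- 1# , x) ∷ [] ≋ []
    cancel x = mk≋ cancel-at
      where
      cancel-at : ∀ b → coeff _≟_ b ((1# , x) ∷ (- 1# , x) ∷ []) ≈ 0#
      cancel-at b with x ≟ b
      ... | yes x≡b = ≈-trans (+-cong ≈-refl (≈-trans (coeff-here _ [] x≡b) (+-identityʳ _))) (-‿inverseʳ 1#)
      ... | no x≢b  = coeff-there _ [] x≢b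

    ++-swap : ∀ l₁ l₂ l₃ → l₁ ++ (l₂ ++ l₃) ≋ l₂ ++ (l₁ ++ l₃)
    ++-swap l₁ l₂ l₃ = ≋-trans (≋-reflexive (sym (List.++-assoc l₁ l₂ l₃)))
      (≋-trans (++-cong (++-comm l₁ l₂) ≋-refl) (≋-reflexive (List.++-assoc l₂ l₁ l₃)))

    concatMap-partition : ∀ {A : Set} (f : A → LC B) (q : A → Bool) xs →
      concatMap f xs ≋ concatMap f (filterᵇ (not ∘ q) xs) ++ concatMap f (filterᵇ q xs)
    concatMap-partition f q []       = ≋-refl
    concatMap-partition f q (x ∷ xs) with q x
    ... | true  = ≋-trans (++-cong ≋-refl (concatMap-partition f q xs))
                    (++-swap (f x) (concatMap f (filterᵇ (not ∘ q) xs)) (concatMap f (filterᵇ q xs)))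
    ... | false = ≋-trans (++-cong ≋-refl (concatMap-partition f q xs))
                    (≋-reflexive (sym (List.++-assoc (f x) (concatMap f (filterᵇ (not ∘ q) xs))
                                                           (concatMap f (filterᵇ q xs)))))

    linSum : (B → Carrier) → LC B → Carrier
    linSum f []            = 0#
    linSum f ((k , b) ∷ l) = k * f b + linSum f l

    without : B → LC B → LC B
    without b []             = []
    without b ((k , b') ∷ l) with b' ≟ b
    ... | yes _ = without b l
    ... | no  _ = (k , b') ∷ without b l

    linSum-without : ∀ f b l → linSum f l ≈ coeff _≟_ b l * f b + linSum f (without b l)
    linSum-without f b []             = ≈-sym (≈-trans (+-cong (zeroˡ _) ≈-refl) (+-identityˡ _))
    linSum-without f b ((k , b') ∷ l) with b' ≟ b
    ... | yes refl = begin
      k * f b + linSum f l                                       ≈⟨ +-cong ≈-refl (linSum-without f b l) ⟩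
      k * f b + (coeff _≟_ b l * f b + linSum f (without b l))   ≈⟨ +-assoc _ _ _ ⟨
      (k * f b + coeff _≟_ b l * f b) + linSum f (without b l)   ≈⟨ +-cong (distribʳ _ _ _) ≈-refl ⟨
      (k + coeff _≟_ b l) * f b + linSum f (without b l)         ∎
    ... | no _ = begin
      k * f b' + linSum f l                                      ≈⟨ +-cong ≈-refl (linSum-without f b l) ⟩
      k * f b' + (coeff _≟_ b l * f b + linSum f (without b l))  ≈⟨ +-assoc _ _ _ ⟨
      (k * f b' + coeff _≟_ b l * f b) + linSum f (without b l)  ≈⟨ +-cong (+-comm _ _) ≈-refl ⟩
      (coeff _≟_ b l * f b + k * f b') + linSum f (without b l)  ≈⟨ +-assoc _ _ _ ⟩
      coeff _≟_ b l * f b + (k * f b' + linSum f (without b l))  ∎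

    coeff-without-self : ∀ b l → coeff _≟_ b (without b l) ≈ 0#
    coeff-without-self b []             = ≈-refl
    coeff-without-self b ((k , b') ∷ l) with b' ≟ b
    ... | yes _   = coeff-without-self b l
    ... | no b'≢b = ≈-trans (coeff-there k (without b l) b'≢b) (coeff-without-self b l)

    coeff-without-other : ∀ b b'' l → ¬ b ≡ b'' → coeff _≟_ b'' (without b l) ≈ coeff _≟_ b'' l
    coeff-without-other b b'' []             b≢b'' = ≈-refl
    coeff-without-other b b'' ((k , b') ∷ l) b≢b'' with b' ≟ b
    ... | yes refl = ≈-trans (coeff-without-other b b'' l b≢b'') (≈-sym (coeff-there k l b≢b''))
    ... | no _ with b' ≟ b''
    ...   | yes _ = +-cong ≈-refl (coeff-without-other b b'' l b≢b'')
    ...   | no _  = coeff-without-other b b'' l b≢b''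

    without-cong : ∀ b {l l'} → l ≋ l' → without b l ≋ without b l'
    without-cong b {l} {l'} e = mk≋ at
      where
      at : ∀ b'' → coeff _≟_ b'' (without b l) ≈ coeff _≟_ b'' (without b l')
      at b'' with b ≟ b''
      ... | yes refl  = ≈-trans (coeff-without-self b l) (≈-sym (coeff-without-self b l'))
      ... | no b≢b''  = ≈-trans (coeff-without-other b b'' l b≢b'')
                          (≈-trans (coeff-≈ e b'') (≈-sym (coeff-without-other b b'' l' b≢b'')))

    length-without : ∀ b l → length (without b l) ≤ length l
    length-without b []             = z≤n
    length-without b ((k , b') ∷ l) with b' ≟ b
    ... | yes _ = ℕ.m≤n⇒m≤1+n (length-without b l)
    ... | no _  = s≤s (length-without b l)

    length-without-head : ∀ k b l → length (without b ((k , b) ∷ l)) ≤ length l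
    length-without-head k b l with b ≟ b
    ... | yes _   = length-without b l
    ... | no b≢b  = ⊥-elim (b≢b refl)

    -- Removing all terms on one basis element makes progress on at least one side.
    linSum-cong : ∀ f {l l'} → l ≋ l' → linSum f l ≈ linSum f l'
    linSum-cong f {l} {l'} = go _ l l' ℕ.≤-refl
      where
      split-at : ∀ b {l l'} → l ≋ l' → linSum f (without b l) ≈ linSum f (without b l') → linSum f l ≈ linSum f l'
      split-at b {l} {l'} e rest = begin
        linSum f l                                         ≈⟨ linSum-without f b l ⟩
        coeff _≟_ b l * f b + linSum f (without b l)       ≈⟨ +-cong (*-cong (coeff-≈ e b) ≈-refl) rest ⟩
        coeff _≟_ b l' * f b + linSum f (without b l')     ≈⟨ linSum-without f b l' ⟨
        linSum f l'                                        ∎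

      go : ∀ n l l' → length l Nat.+ length l' ≤ n → l ≋ l' → linSum f l ≈ linSum f l'
      go n       []             []              _        _ = ≈-refl
      go (suc n) ((k , b) ∷ l)  l'              (s≤s le) e = split-at b e (go n _ _
        (ℕ.≤-trans (ℕ.+-mono-≤ (length-without-head k b l) (length-without b l')) le) (without-cong b e))
      go (suc n) []             ((k , b) ∷ l')  (s≤s le) e = split-at b e (go n [] _
        (ℕ.≤-trans (length-without-head k b l') le) (without-cong b e))

    linSum-cong-on : ∀ (P : B → Set) {f g} l → All (P ∘ proj₂) l → (∀ b → P b → f b ≈ g b) →
                     linSum f l ≈ linSum g l
    linSum-cong-on P []            []         f≈g = ≈-refl
    linSum-cong-on P ((k , b) ∷ l) (Pb ∷ Pl) f≈g = +-cong (*-cong ≈-refl (f≈g b Pb)) (linSum-cong-on P l Pl f≈g)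

  module _ {B C : Set} (_≟B_ : DecidableEquality B) (_≟C_ : DecidableEquality C) where

    extend⁺ : ∀ {P : B → Set} {Q : C → Set} (f : B → LC C) {l} → All (P ∘ proj₂) l →
              (∀ {b} → P b → All (Q ∘ proj₂) (f b)) → All (Q ∘ proj₂) (extend f l)
    extend⁺ f Pl fQ = concat⁺ (map⁺ (All.map (λ Pb → map⁺ (fQ Pb)) Pl))

    coeff-scale : ∀ w k (l : LC C) → coeff _≟C_ w (map (λ { (k' , c) → (k * k' , c) }) l) ≈ k * coeff _≟C_ w l
    coeff-scale w k []             = ≈-sym (zeroʳ k)
    coeff-scale w k ((k' , c) ∷ l) with c ≟C w
    ... | yes _ = ≈-trans (+-cong ≈-refl (coeff-scale w k l)) (≈-sym (distribˡ _ _ _))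
    ... | no _  = coeff-scale w k l

    coeff-extend : ∀ (f : B → LC C) w l → coeff _≟C_ w (extend f l) ≈ linSum _≟B_ (λ b → coeff _≟C_ w (f b)) l
    coeff-extend f w []            = ≈-refl
    coeff-extend f w ((k , b) ∷ l) =
      ≈-trans (coeff-++ _≟C_ w (map (λ { (k' , c) → (k * k' , c) }) (f b)) (extend f l))
              (+-cong (coeff-scale w k (f b)) (coeff-extend f w l))

    extend-cong : ∀ (f : B → LC C) {l l'} → _≋_ _≟B_ l l' → _≋_ _≟C_ (extend f l) (extend f l')
    extend-cong f {l} {l'} e = mk≋ λ w → begin
      coeff _≟C_ w (extend f l)                          ≈⟨ coeff-extend f w l ⟩
      linSum _≟B_ (λ b → coeff _≟C_ w (f b)) l           ≈⟨ linSum-cong _≟B_ _ e ⟩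
      linSum _≟B_ (λ b → coeff _≟C_ w (f b)) l'          ≈⟨ coeff-extend f w l' ⟨
      coeff _≟C_ w (extend f l')                         ∎

    extend-cong-on : ∀ (P : B → Set) (f g : B → LC C) l → All (P ∘ proj₂) l →
                     (∀ b → P b → _≋_ _≟C_ (f b) (g b)) → _≋_ _≟C_ (extend f l) (extend g l)
    extend-cong-on P f g l Pl f≋g = mk≋ λ w → begin
      coeff _≟C_ w (extend f l)                          ≈⟨ coeff-extend f w l ⟩
      linSum _≟B_ (λ b → coeff _≟C_ w (f b)) l           ≈⟨ linSum-cong-on _≟B_ P l Pl (λ b Pb → coeff-≈ (f≋g b Pb) w) ⟩
      linSum _≟B_ (λ b → coeff _≟C_ w (g b)) l           ≈⟨ coeff-extend g w l ⟨
      coeff _≟C_ w (extend g l)                          ∎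

    relabel-extend : ∀ (h : B → C) l → _≋_ _≟C_ (map (map₂ h) l) (extend (λ b → (1# , h b) ∷ []) l)
    relabel-extend h l = mk≋ (λ w → at w l)
      where
      at : ∀ w l → coeff _≟C_ w (map (map₂ h) l) ≈ coeff _≟C_ w (extend (λ b → (1# , h b) ∷ []) l)
      at w []            = ≈-refl
      at w ((k , b) ∷ l) with h b ≟C w
      ... | yes _ = +-cong (≈-sym (*-identityʳ k)) (at w l)
      ... | no _  = at w l

    relabel-cong : ∀ (h : B → C) {l l'} → _≋_ _≟B_ l l' → _≋_ _≟C_ (map (map₂ h) l) (map (map₂ h) l')
    relabel-cong h {l} {l'} e =
      ≋-trans _≟C_ (relabel-extend h l)
        (≋-trans _≟C_ (extend-cong (λ b → (1# , h b) ∷ []) e) (≋-sym _≟C_ (relabel-extend h l')))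

-- Leaf counts

open import Data.Nat using (_+_)

NonTrivial : Tree → Set
NonTrivial t = 2 ≤ leaves t

1≤leaves : ∀ t → 1 ≤ leaves t
1≤leaves leaf         = s≤s z≤n
1≤leaves (node a _ _) = ℕ.≤-trans (1≤leaves a) (ℕ.m≤m+n _ _)

nonTrivial-node : ∀ a b ts → NonTrivial (node a b ts)
nonTrivial-node a b ts = ℕ.+-mono-≤ (1≤leaves a) (ℕ.≤-trans (1≤leaves b) (ℕ.m≤m+n _ _))

nonTrivial-≢leaf : ∀ {t} → ¬ t ≡ leaf → NonTrivial t
nonTrivial-≢leaf {leaf}        t≢leaf = ⊥-elim (t≢leaf refl)
nonTrivial-≢leaf {node a b ts} _      = nonTrivial-node a b ts

leaves-graft : ∀ t ts → leaves (graft (t ∷ ts)) ≡ leavesL (t ∷ ts)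
leaves-graft t []      = sym (ℕ.+-identityʳ _)
leaves-graft t (_ ∷ _) = refl

leavesL-++ : ∀ xs ys → leavesL (xs ++ ys) ≡ leavesL xs + leavesL ys
leavesL-++ []       ys = refl
leavesL-++ (x ∷ xs) ys = trans (cong (leaves x +_) (leavesL-++ xs ys)) (sym (ℕ.+-assoc (leaves x) _ _))

suc-+-assoc : ∀ x {y z w} → suc y ≡ z + w → suc (x + y) ≡ (x + z) + w
suc-+-assoc x {y} {z} {w} e = begin
  suc (x + y)  ≡⟨ ℕ.+-suc x y ⟨
  x + suc y    ≡⟨ cong (x +_) e ⟩
  x + (z + w)  ≡⟨ ℕ.+-assoc x z w ⟨
  (x + z) + w  ∎
  where open ≡-Reasoning

-- Grafting identifies the root edge of one factor with a leaf of the other.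
LeafSum : Tree → Tree → Tree → Set
LeafSum x y z = suc (leaves z) ≡ leaves x + leaves y

mutual
  leaves-⊛ : ∀ x y → All (LeafSum x y) (x ⊛ y)
  leaves-⊛ leaf          y             = refl ∷ []
  leaves-⊛ (node a b as) leaf          = ℕ.+-comm 1 (leaves (node a b as)) ∷ []
  leaves-⊛ (node a b as) (node c d cs) =
    ++⁺ (leaves-prec a b as (node c d cs)) (++⁺ (leaves-dot a b as c d cs) (leaves-succ (node a b as) c d cs))

  leaves-lastMul : ∀ h hs y → All (λ l → suc (leavesL l) ≡ leavesL (h ∷ hs) + leaves y) (lastMul h hs y)
  leaves-lastMul h []        y = map⁺ (All.map (λ {t} e →
    trans (cong suc (ℕ.+-identityʳ (leaves t))) (trans e (cong (_+ leaves y) (sym (ℕ.+-identityʳ (leaves h))))))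
    (leaves-⊛ h y))
  leaves-lastMul h (h' ∷ hs) y = map⁺ (All.map (suc-+-assoc (leaves h)) (leaves-lastMul h' hs y))

  leaves-prec : ∀ a b as y → All (LeafSum (node a b as) y) (prec a b as y)
  leaves-prec a b as y = map⁺ (All.map (λ {l} e → trans (cong suc (leaves-graft a l)) (suc-+-assoc (leaves a) e))
    (leaves-lastMul b as y))

  leaves-dot : ∀ a b as c d cs → All (LeafSum (node a b as) (node c d cs)) (dot a b as c d cs)
  leaves-dot a b as c d cs = map⁺ (All.map (λ {l} e → begin
      suc (leaves (graft (a ∷ (l ++ d ∷ cs))))       ≡⟨ cong suc (leaves-graft a (l ++ d ∷ cs)) ⟩
      suc (leaves a + leavesL (l ++ d ∷ cs))         ≡⟨ cong (λ n → suc (leaves a + n)) (leavesL-++ l (d ∷ cs)) ⟩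
      suc (leaves a + (leavesL l + leavesL (d ∷ cs))) ≡⟨ cong suc (ℕ.+-assoc (leaves a) _ _) ⟨
      suc (leaves a + leavesL l + leavesL (d ∷ cs))   ≡⟨ cong (_+ leavesL (d ∷ cs)) (suc-+-assoc (leaves a) e) ⟩
      leaves (node a b as) + leaves c + leavesL (d ∷ cs) ≡⟨ ℕ.+-assoc (leaves (node a b as)) _ _ ⟩
      leaves (node a b as) + leaves (node c d cs)     ∎)
    (leaves-lastMul b as c))
    where open ≡-Reasoning

  leaves-succ : ∀ x c d cs → All (LeafSum x (node c d cs)) (succ x c d cs)
  leaves-succ x c d cs = map⁺ (All.map (λ e → trans (cong (_+ leavesL (d ∷ cs)) e) (ℕ.+-assoc (leaves x) (leaves c) _))
    (leaves-⊛ x c))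

leaves-prodList : ∀ gs → All (λ z → leaves z + length gs ≡ suc (leavesL gs)) (prodList gs)
leaves-prodList []       = refl ∷ []
leaves-prodList (g ∷ gs) = concat⁺ (map⁺ (All.map (λ {u} eu → All.map (λ {z} ez → begin
    leaves z + suc (length gs)    ≡⟨ ℕ.+-suc (leaves z) (length gs) ⟩
    suc (leaves z) + length gs    ≡⟨ cong (_+ length gs) ez ⟩
    leaves g + leaves u + length gs ≡⟨ ℕ.+-assoc (leaves g) (leaves u) (length gs) ⟩
    leaves g + (leaves u + length gs) ≡⟨ cong (leaves g +_) eu ⟩
    leaves g + suc (leavesL gs)   ≡⟨ ℕ.+-suc (leaves g) (leavesL gs) ⟩
    suc (leavesL (g ∷ gs))        ∎)
  (leaves-⊛ g u)) (leaves-prodList gs)))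
  where open ≡-Reasoning

nonTrivial-prodList : ∀ g gs → NonTrivial g → All NonTrivial (prodList (g ∷ gs))
nonTrivial-prodList g gs 2≤g = concat⁺ (map⁺ (All.universal (λ u → All.map (λ {z} ez →
    ℕ.+-cancelˡ-≤ 1 2 (leaves z) (ℕ.≤-trans (ℕ.+-mono-≤ 2≤g (1≤leaves u)) (ℕ.≤-reflexive (sym ez))))
  (leaves-⊛ g u)) (prodList gs)))

leaves-split : ∀ {z p g t} m → z + m ≡ suc g → g + p ≡ t + m → z + p ≡ suc t
leaves-split {z} {p} {g} {t} m e e' = ℕ.+-cancelʳ-≡ m (z + p) (suc t) (begin
  z + p + m    ≡⟨ ℕ.+-assoc z p m ⟩
  z + (p + m)  ≡⟨ cong (z +_) (ℕ.+-comm p m) ⟩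
  z + (m + p)  ≡⟨ ℕ.+-assoc z m p ⟨
  z + m + p    ≡⟨ cong (_+ p) e ⟩
  suc (g + p)  ≡⟨ cong suc e' ⟩
  suc t + m    ∎)
  where open ≡-Reasoning

-- Cuts

open CutData

-- A cut edge is both a leaf of the root component and the root edge of a piece.
Balanced : Tree → CutData → Set
Balanced t cd =
  All NonTrivial (pieces cd) × leavesL (pieces cd) + leaves (root cd) ≡ leaves t + length (pieces cd)

ChainBalanced : List Tree → List Tree × List Tree × Bool → Set
ChainBalanced ss (gs , ps , _) =
  All NonTrivial gs × leavesL gs + leavesL ps ≡ leavesL ss + length gs × (∀ p → NonTrivial (graft (p ∷ ps)))

leaves-balance-++ : ∀ g gs {lp lps la lb} →
  leavesL g + lp ≡ la + length g → leavesL gs + lps ≡ lb + length gs →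
  leavesL (g ++ gs) + (lp + lps) ≡ (la + lb) + length (g ++ gs)
leaves-balance-++ g gs {lp} {lps} {la} {lb} e e' = begin
  leavesL (g ++ gs) + (lp + lps)                  ≡⟨ cong (_+ (lp + lps)) (leavesL-++ g gs) ⟩
  (leavesL g + leavesL gs) + (lp + lps)           ≡⟨ interchange (leavesL g) (leavesL gs) lp lps ⟩
  (leavesL g + lp) + (leavesL gs + lps)           ≡⟨ cong₂ _+_ e e' ⟩
  (la + length g) + (lb + length gs)              ≡⟨ interchange la (length g) lb (length gs) ⟩
  (la + lb) + (length g + length gs)              ≡⟨ cong ((la + lb) +_) (List.length-++ g) ⟨
  (la + lb) + length (g ++ gs)                    ∎
  where open ≡-Reasoning

mutual
  below-balanced : ∀ s → All (Balanced s) (below s)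
  below-balanced leaf          = ([] , refl) ∷ []
  below-balanced (node a b as) =
    (nonTrivial-node a b as ∷ [] , cong (_+ 1) (ℕ.+-identityʳ _)) ∷ All.map proj₁ (inside-balanced a b as)

  inside-balanced : ∀ a b as → All (λ cd → Balanced (node a b as) cd × NonTrivial (root cd)) (inside (node a b as))
  inside-balanced a b as = concat⁺ (map⁺ (All.map (λ { {cutData g p _} (g⁺ , e) →
      map⁺ (All.map (λ { {gs , ps , _} (gs⁺ , e' , root⁺) →
          (++⁺ g⁺ gs⁺ , trans (cong (leavesL (g ++ gs) +_) (leaves-graft p ps)) (leaves-balance-++ g gs e e'))
          , root⁺ p })
        (chain-balanced b as)) })
    (below-balanced a)))

  chain-balanced : ∀ s ss → All (ChainBalanced (s ∷ ss)) (chain s ss)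
  chain-balanced s []        = map⁺ (All.map (λ { {cutData g p _} (g⁺ , e) →
      g⁺ , trans (cong (leavesL g +_) (ℕ.+-identityʳ (leaves p)))
                 (trans e (cong (_+ length g) (sym (ℕ.+-identityʳ (leaves s)))))
         , λ q → nonTrivial-node q p [] })
    (below-balanced s))
  chain-balanced s (s' ∷ ss) = concat⁺ (map⁺ (All.map (λ { {cutData g p _} (g⁺ , e) →
      map⁺ (All.map (λ { {gs , ps , _} (gs⁺ , e' , _) →
          ++⁺ g⁺ gs⁺ , leaves-balance-++ g gs e e' , λ q → nonTrivial-node q p ps })
        (chain-balanced s' ss)) })
    (below-balanced s)))

isEmptyCut : CutData → Bool
isEmptyCut cd = null (pieces cd)

emptyCut : Tree → CutData
emptyCut t = cutData [] t true

-- Cut choices are combined by concatenating the pieces, so a combination is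
-- empty only if both ingredients are.
filterᵇ-empty-combination : ∀ {X : Set} (q : X → Bool) (φ : CutData → List Tree × List Tree × Bool → X) s ch →
  filterᵇ isEmptyCut (below s) ≡ emptyCut s ∷ [] →
  (∀ cd e → isEmptyCut cd ≡ false → q (φ cd e) ≡ false) →
  filterᵇ q (concatMap (λ cd → map (φ cd) ch) (below s)) ≡ map (φ (emptyCut s)) (filterᵇ (q ∘ φ (emptyCut s)) ch) ++ []
filterᵇ-empty-combination q φ s ch below-empty q-false = begin
  filterᵇ q (concatMap (λ cd → map (φ cd) ch) (below s))
    ≡⟨ filterᵇ-concatMap q _ (below s) ⟩
  concatMap F (below s)
    ≡⟨ concatMap-filterᵇ isEmptyCut F vanishes (below s) ⟩
  concatMap F (filterᵇ isEmptyCut (below s))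
    ≡⟨ cong (concatMap F) below-empty ⟩
  F (emptyCut s) ++ []
    ≡⟨ cong (_++ []) (filterᵇ-map q (φ (emptyCut s)) ch) ⟩
  map (φ (emptyCut s)) (filterᵇ (q ∘ φ (emptyCut s)) ch) ++ [] ∎
  where
  open ≡-Reasoning
  F : CutData → List _
  F cd = filterᵇ q (map (φ cd) ch)
  vanishes : ∀ cd → isEmptyCut cd ≡ false → F cd ≡ []
  vanishes cd ne = trans (filterᵇ-map q (φ cd) ch) (cong (map (φ cd)) (filterᵇ-false _ (λ e → q-false cd e ne) ch))

mutual
  below-empty : ∀ s → filterᵇ isEmptyCut (below s) ≡ emptyCut s ∷ []
  below-empty leaf          = refl
  below-empty (node a b as) = inside-empty a b as

  inside-empty : ∀ a b as → filterᵇ isEmptyCut (inside (node a b as)) ≡ emptyCut (node a b as) ∷ []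
  inside-empty a b as =
    trans (filterᵇ-empty-combination isEmptyCut _ a (chain b as) (below-empty a) (λ cd e → null-++ (pieces cd) (proj₁ e)))
          (cong (λ l → map _ l ++ []) (chain-empty b as))

  chain-empty : ∀ s ss → filterᵇ (null ∘ proj₁) (chain s ss) ≡ ([] , s ∷ ss , true) ∷ []
  chain-empty s []        = trans (filterᵇ-map _ _ (below s)) (cong (map _) (below-empty s))
  chain-empty s (s' ∷ ss) =
    trans (filterᵇ-empty-combination (null ∘ proj₁) _ s (chain s' ss) (below-empty s) (λ cd e → null-++ (pieces cd) (proj₁ e)))
          (cong (λ l → map _ l ++ []) (chain-empty s' ss))

-- Reduced coproducts

module Connectedness {c ℓ : Level} (K : Field c ℓ) where
  open Field K using (1#; -_)
  open Lin K
  open LinearCombinations K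

  _≟P_ : DecidableEquality (Tree × Tree)
  _≟P_ = ≡-dec _≟T_ _≟T_

  infix 4 _≋ᴾ_ _≋ⱽ_
  _≋ᴾ_ : LC (Tree × Tree) → LC (Tree × Tree) → Set ℓ
  _≋ᴾ_ = _≋_ _≟P_

  _≋ⱽ_ : ∀ {n} → LC (Vec Tree n) → LC (Vec Tree n) → Set ℓ
  _≋ⱽ_ = _≋_ _≟V_

  select : Dir → CutData → Bool
  select left  = isLeft
  select right = isRight

  -- The terms of Δ̃ d t coming from cuts that are neither empty nor total.
  reducedΔ : Dir → Tree → LC (Tree × Tree)
  reducedΔ d t = concatMap cutTerm (filterᵇ (not ∘ isEmptyCut) (filterᵇ (select d) (inside t)))

  cutTerms-inside : ∀ d a b as → let t = node a b as in
    concatMap cutTerm (filterᵇ (select d) (inside t)) ≋ᴾ reducedΔ d t ++ concatMap cutTerm (filterᵇ (select d) (emptyCut t ∷ []))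
  cutTerms-inside d a b as = begin
    concatMap cutTerm (filterᵇ (select d) (inside t))
      ≈⟨ concatMap-partition _≟P_ cutTerm isEmptyCut (filterᵇ (select d) (inside t)) ⟩
    reducedΔ d t ++ concatMap cutTerm (filterᵇ isEmptyCut (filterᵇ (select d) (inside t)))
      ≡⟨ cong (λ l → reducedΔ d t ++ concatMap cutTerm l) (filterᵇ-comm isEmptyCut (select d) (inside t)) ⟩
    reducedΔ d t ++ concatMap cutTerm (filterᵇ (select d) (filterᵇ isEmptyCut (inside t)))
      ≡⟨ cong (λ l → reducedΔ d t ++ concatMap cutTerm (filterᵇ (select d) l)) (inside-empty a b as) ⟩
    reducedΔ d t ++ concatMap cutTerm (filterᵇ (select d) (emptyCut t ∷ [])) ∎
    where
    t = node a b as
    open import Relation.Binary.Reasoning.Setoid (≋-setoid _≟P_)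

  -- The total cut (for ←) and the empty cut (for →) cancel the correction term.
  Δ̃≋reducedΔ : ∀ d t → NonTrivial t → Δ̃ d t ≋ᴾ reducedΔ d t
  Δ̃≋reducedΔ d     leaf           (s≤s ())
  Δ̃≋reducedΔ left  t@(node a b as) _ = begin
    Δ̃ left t
      ≡⟨ cong (λ l → concatMap cutTerm l ++ (- 1# , (t , leaf)) ∷ []) (List.filter-++ (T? ∘ isLeft) (inside t) _) ⟩
    concatMap cutTerm (filterᵇ isLeft (inside t) ++ cutData (t ∷ []) leaf false ∷ []) ++ (- 1# , (t , leaf)) ∷ []
      ≡⟨ cong (_++ _) (List.concatMap-++ cutTerm (filterᵇ isLeft (inside t)) _) ⟩
    (concatMap cutTerm (filterᵇ isLeft (inside t)) ++ (1# , (t , leaf)) ∷ []) ++ (- 1# , (t , leaf)) ∷ []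
      ≡⟨ List.++-assoc (concatMap cutTerm (filterᵇ isLeft (inside t))) _ _ ⟩
    concatMap cutTerm (filterᵇ isLeft (inside t)) ++ (1# , (t , leaf)) ∷ (- 1# , (t , leaf)) ∷ []
      ≈⟨ ++-cong _≟P_ (≋-refl _≟P_) (cancel _≟P_ (t , leaf)) ⟩
    concatMap cutTerm (filterᵇ isLeft (inside t)) ++ []
      ≡⟨ List.++-identityʳ _ ⟩
    concatMap cutTerm (filterᵇ isLeft (inside t))
      ≈⟨ cutTerms-inside left a b as ⟩
    reducedΔ left t ++ []
      ≡⟨ List.++-identityʳ _ ⟩
    reducedΔ left t ∎
    where open import Relation.Binary.Reasoning.Setoid (≋-setoid _≟P_)
  Δ̃≋reducedΔ right t@(node a b as) _ = begin
    Δ̃ right t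
      ≡⟨ cong (λ l → concatMap cutTerm l ++ (- 1# , (leaf , t)) ∷ [])
              (trans (List.filter-++ (T? ∘ isRight) (inside t) _) (List.++-identityʳ _)) ⟩
    concatMap cutTerm (filterᵇ isRight (inside t)) ++ (- 1# , (leaf , t)) ∷ []
      ≈⟨ ++-cong _≟P_ (cutTerms-inside right a b as) (≋-refl _≟P_) ⟩
    (reducedΔ right t ++ (1# , (leaf , t)) ∷ []) ++ (- 1# , (leaf , t)) ∷ []
      ≡⟨ List.++-assoc (reducedΔ right t) _ _ ⟩
    reducedΔ right t ++ (1# , (leaf , t)) ∷ (- 1# , (leaf , t)) ∷ []
      ≈⟨ ++-cong _≟P_ (≋-refl _≟P_) (cancel _≟P_ (leaf , t)) ⟩
    reducedΔ right t ++ []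
      ≡⟨ List.++-identityʳ _ ⟩
    reducedΔ right t ∎
    where open import Relation.Binary.Reasoning.Setoid (≋-setoid _≟P_)

  Splits : Tree → Tree × Tree → Set
  Splits t (g , p) = NonTrivial g × NonTrivial p × leaves g + leaves p ≡ suc (leaves t)

  cutTerm-splits : ∀ t cd → Balanced t cd → NonTrivial (root cd) → T (not (isEmptyCut cd)) →
                   All (Splits t ∘ proj₂) (cutTerm cd)
  cutTerm-splits t (cutData (g ∷ gs) p _) (g⁺ ∷ _ , balance) p⁺ _ =
    map⁺ (map⁺ (All.zipWith (λ (ez , z⁺) → z⁺ , p⁺ , leaves-split (length (g ∷ gs)) ez balance)
                            (leaves-prodList (g ∷ gs) , nonTrivial-prodList g gs g⁺)))

  reducedΔ-splits : ∀ d t → All (Splits t ∘ proj₂) (reducedΔ d t)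
  reducedΔ-splits d leaf          = []
  reducedΔ-splits d (node a b as) =
    concat⁺ (map⁺ (All.zipWith (λ { {cd} ((bal , root⁺) , nonEmpty) → cutTerm-splits (node a b as) cd bal root⁺ nonEmpty })
      (filter⁺ (T? ∘ not ∘ isEmptyCut) (filter⁺ (T? ∘ select d) (inside-balanced a b as)) ,
       all-filter (T? ∘ not ∘ isEmptyCut) (filterᵇ (select d) (inside (node a b as))))))

  leavesⱽ : ∀ {m} → Vec Tree m → ℕ
  leavesⱽ v = Vec.sum (Vec.map leaves v)

  applyAt-cong-on : ∀ {n} {f g : Tree → LC (Tree × Tree)} (i : Fin (suc n)) v → AllV.All NonTrivial v →
                    (∀ t → NonTrivial t → f t ≋ᴾ g t) → applyAt f i v ≋ⱽ applyAt g i v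
  applyAt-cong-on         zero    (t ∷ ts) (t⁺ ∷ _)   f≋g = relabel-cong _≟P_ _≟V_ (λ (g , p) → g ∷ p ∷ ts) (f≋g t t⁺)
  applyAt-cong-on {suc n} (suc i) (t ∷ ts) (_ ∷ ts⁺) f≋g = relabel-cong _≟V_ _≟V_ (t ∷_) (applyAt-cong-on i ts ts⁺ f≋g)

  applyAt-splits : ∀ {n} {f : Tree → LC (Tree × Tree)} (i : Fin (suc n)) v → AllV.All NonTrivial v →
                   (∀ t → All (Splits t ∘ proj₂) (f t)) →
                   All ((λ w → AllV.All NonTrivial w × leavesⱽ w ≡ suc (leavesⱽ v)) ∘ proj₂) (applyAt f i v)
  applyAt-splits zero (t ∷ ts) (_ ∷ ts⁺) f-splits =
    map⁺ (All.map (λ { {_ , (g , p)} (g⁺ , p⁺ , e) →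
      g⁺ ∷ p⁺ ∷ ts⁺ , trans (sym (ℕ.+-assoc (leaves g) (leaves p) _)) (cong (_+ leavesⱽ ts) e) })
      (f-splits t))
  applyAt-splits {suc n} (suc i) (t ∷ ts) (t⁺ ∷ ts⁺) f-splits =
    map⁺ (All.map (λ (w⁺ , e) → t⁺ ∷ w⁺ , trans (cong (leaves t +_) e) (ℕ.+-suc (leaves t) _))
      (applyAt-splits i ts ts⁺ f-splits))

  ⟦_⟧ʳ : ∀ {n} → Ops n → LC Tree → LC (Vec Tree (suc n))
  ⟦ idOp ⟧ʳ       a = ⟦ idOp ⟧ a
  ⟦ step P i d ⟧ʳ a = extend (applyAt (reducedΔ d) i) (⟦ P ⟧ʳ a)

  size : LC Tree → ℕ
  size a = sum (map (leaves ∘ proj₂) a)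

  leaves≤size : ∀ a → All ((_≤ size a) ∘ leaves ∘ proj₂) a
  leaves≤size []            = []
  leaves≤size ((_ , t) ∷ a) =
    ℕ.m≤m+n (leaves t) (size a) ∷ All.map (λ le → ℕ.≤-trans le (ℕ.m≤n+m (size a) (leaves t))) (leaves≤size a)

  Bounded : ℕ → ∀ {m} → Vec Tree m → Set
  Bounded N v = AllV.All NonTrivial v × leavesⱽ v ≤ N

  ⟦⟧ʳ-bounded : ∀ {a} → InAPlus a → ∀ {n} (P : Ops n) → All (Bounded (size a + n) ∘ proj₂) (⟦ P ⟧ʳ a)
  ⟦⟧ʳ-bounded {a} a⁺ idOp         =
    map⁺ (All.zipWith (λ (t≢leaf , le) → nonTrivial-≢leaf t≢leaf ∷ [] , ℕ.+-monoˡ-≤ 0 le) (a⁺ , leaves≤size a))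
  ⟦⟧ʳ-bounded {a} a⁺ (step {n} P i d) =
    extend⁺ _≟V_ _≟V_ (applyAt (reducedΔ d) i) (⟦⟧ʳ-bounded a⁺ P) λ { {v} (v⁺ , le) →
      All.map (λ (w⁺ , e) → w⁺ , ℕ.≤-trans (ℕ.≤-reflexive e)
                                   (ℕ.≤-trans (s≤s le) (ℕ.≤-reflexive (sym (ℕ.+-suc (size a) n)))))
        (applyAt-splits i v v⁺ (reducedΔ-splits d)) }

  ⟦⟧≋⟦⟧ʳ : ∀ {a} → InAPlus a → ∀ {n} (P : Ops n) → ⟦ P ⟧ a ≋ⱽ ⟦ P ⟧ʳ a
  ⟦⟧≋⟦⟧ʳ a⁺ idOp         = ≋-refl _≟V_
  ⟦⟧≋⟦⟧ʳ a⁺ (step P i d) =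
    ≋-trans _≟V_ (extend-cong _≟V_ _≟V_ (applyAt (Δ̃ d) i) (⟦⟧≋⟦⟧ʳ a⁺ P))
      (extend-cong-on _≟V_ _≟V_ (AllV.All NonTrivial) _ _ _ (All.map proj₁ (⟦⟧ʳ-bounded a⁺ P))
        (λ v v⁺ → applyAt-cong-on i v v⁺ (Δ̃≋reducedΔ d)))

  leavesⱽ-lower : ∀ {m} (v : Vec Tree m) → AllV.All NonTrivial v → m + m ≤ leavesⱽ v
  leavesⱽ-lower []       []               = z≤n
  leavesⱽ-lower {suc m} (t ∷ ts) (t⁺ ∷ ts⁺) =
    ℕ.≤-trans (ℕ.≤-reflexive (cong suc (ℕ.+-suc m m))) (ℕ.+-mono-≤ t⁺ (leavesⱽ-lower ts ts⁺))

  ⟦⟧ʳ-vanishes : ∀ {a} → InAPlus a → (P : Ops (size a)) → ⟦ P ⟧ʳ a ≡ []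
  ⟦⟧ʳ-vanishes {a} a⁺ P with ⟦ P ⟧ʳ a | ⟦⟧ʳ-bounded a⁺ P
  ... | []          | []             = refl
  ... | (_ , v) ∷ _ | (v⁺ , le) ∷ _ =
    ⊥-elim (ℕ.<⇒≱ (ℕ.+-mono-< (ℕ.n<1+n N) (ℕ.n<1+n N)) (ℕ.≤-trans (leavesⱽ-lower v v⁺) le))
    where N = size a

mainTheorem14 : ∀ {c ℓ : Level} (K : Field c ℓ) →
    let open Lin K in
    (a : LC Tree) → InAPlus a →
    Σ ℕ λ nₐ → (P : Ops nₐ) → IsZero _≟V_ (⟦ P ⟧ a)
mainTheorem14 K a a⁺ = size a , λ P v →
  subst (λ l → coeff _≟V_ v (⟦ P ⟧ a) ≈ coeff _≟V_ v l) (⟦⟧ʳ-vanishes a⁺ P) (coeff-≈ (⟦⟧≋⟦⟧ʳ a⁺ P) v)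
  where
  open Lin K
  open Field K using (_≈_)
  open LinearCombinations K
  open Connectedness K
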